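{- (i) The class of matroids is closed under taking duals, deletions and contractions, and hence under taking minors. (ii) The class of hereditary collections satisfying the point replacement property is closed under deletion, but is not closed under contractions nor under duals, and hence not under minors. (iii) A hereditary collection $\mathcal{H}$ is a matroid if and only if every minor of $\mathcal{H}$ satisfies the point replacement property.
   Context: A hereditary collection is a pair $\mathcal{H}=(E,\mathscr{H})$, $E$ a finite set, $\mathscr{H}\subseteq\mathcal{P}(E)$ nonempty and closed under subsets; a basis is an inclusion-maximal member of $\mathscr{H}$. A matroid is a hereditary collection such that whenever $I,J\in\mathscr{H}$ with $|I|=|J|+1$ there is $i\in I\setminus J$ with $J\cup\{i\}\in\mathscr{H}$. Point replacement: for every $p\in E$ with $\{p\}\in\mathscr{H}$ and every nonempty $J\in\mathscr{H}$ there is $x\in J$ with $(J\setminus\{x\})\cup\{p\}\in\mathscr{H}$. The dual $\mathcal{H}^*=(E,\mathscr{H}^*)$ is the hereditary collection whose bases are exactly the sets $E\setminus B$ for $B$ a basis of $\mathcal{H}$ (and $\mathscr{H}^*$ consists of all subsets of these). For $X\subseteq E$, the deletion is $\mathcal{H}\setminus X=(E\setminus X,\{Y\in\mathscr{H}: Y\subseteq E\setminus X\})$, and the contraction is $\mathcal{H}/X=(E\setminus X,\mathscr{H}/X)$ where, for $Y\subseteq E\setminus X$, $Y\in\mathscr{H}/X$ iff $Y\cup B_X\in\mathscr{H}$ for some subset $B_X\subseteq X$ that is a maximal (with respect to inclusion) member of $\mathscr{H}$ contained in $X$. A minor of $\mathcal{H}$ is a hereditary collection of the form $\mathcal{H}/X\setminus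 Y$ for disjoint $X,Y\subseteq E$ (including $\mathcal{H}$ itself). -}

module Defs where

open import Data.Nat using (ℕ; suc)
open import Data.Fin using (Fin)
open import Data.Fin.Subset
open import Data.Product using (Σ; ∃; _×_)
open import Relation.Nullary using (¬_)
open import Relation.Unary using (Decidable)
open import Relation.Binary.PropositionalEquality using (_≡_)

Family : ℕ → Set₁
Family n = Subset n → Set

-- (E , H) is a hereditary collection on the ground set E ⊆ Fin n:
-- members are subsets of E, H is nonempty, closed under subsets,
-- and membership is decidable (H is an honest finite subset of P(E)).
record IsHC {n : ℕ} (E : Subset n) (H : Family n) : Set where
  field
    ground     : ∀ Y → H Y → Y ⊆ E
    nonempty   : ∃ λ Y → H Y
    hereditary : ∀ X Y → Y ⊆ X → H X → H Y
    decidable  : Decidable H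

IsBasis : ∀ {n} → Family n → Subset n → Set
IsBasis H B = H B × (∀ C → H C → B ⊆ C → C ⊆ B)

IsMaxIn : ∀ {n} → Family n → Subset n → Subset n → Set
IsMaxIn H X B = B ⊆ X × H B × (∀ C → C ⊆ X → H C → B ⊆ C → C ⊆ B)

Augmentation : ∀ {n} → Family n → Set
Augmentation H = ∀ I J → H I → H J → ∣ I ∣ ≡ suc ∣ J ∣ →
  ∃ λ i → i ∈ I × i ∉ J × H (J ∪ ⁅ i ⁆)

IsMatroid : ∀ {n} → Subset n → Family n → Set
IsMatroid E H = IsHC E H × Augmentation H

PointReplacement : ∀ {n} → Subset n → Family n → Set
PointReplacement E H = ∀ p → p ∈ E → H ⁅ p ⁆ → ∀ J → H J → Nonempty J →
  ∃ λ x → x ∈ J × H ((J - x) ∪ ⁅ p ⁆)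

Dual : ∀ {n} → Subset n → Family n → Family n
Dual E H Y = Σ (Subset _) λ B → IsBasis H B × Y ⊆ E ─ B

Del : ∀ {n} → Subset n → Family n → Subset n → Family n
Del E H X Y = H Y × Y ⊆ E ─ X

Contr : ∀ {n} → Subset n → Family n → Subset n → Family n
Contr E H X Y = Y ⊆ E ─ X × Σ (Subset _) λ B → IsMaxIn H X B × H (Y ∪ B)

Minor : ∀ {n} → Subset n → Family n → Subset n → Subset n → Family n
Minor E H X Y = Del (E ─ X) (Contr E H X) Y

MinorGround : ∀ {n} → Subset n → Subset n → Subset n → Subset n
MinorGround E X Y = (E ─ X) ─ Y

-- In a matroid every independent subset of X is at most as large as any maximal one. So maximal
-- independent subsets of X are equicardinal, a contraction does not depend on the maximal set B_X it
-- is taken with, and a maximal independent subset of X is a basis as soon as X contains one.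
-- Augmentation for the dual compares two bases extending one maximal independent subset T of
-- E ∖ (I ∪ J): one avoids J and, if the exchange fails, contains T ∪ (I ∖ J); the other avoids I and
-- lies in T ∪ (J ∖ I). Point replacement holds since a maximal independent subset of J ∪ {p}
-- through p misses at most one point of J.
-- Conversely, given independent I, J with |J| < |I| and p ∈ J ∖ I, point replacement in the minor
-- obtained by contracting I ∩ J and restricting to I ∪ J trades some x ∈ I ∖ J for p inside I. This
-- keeps |I| and shrinks J ∖ I, so by induction J ⊆ I, where any point of I ∖ J augments J.

module Submission where

open import Defs
open import Data.Nat using (ℕ; zero; suc; _+_; _≤_; _<_; s≤s)
open import Data.Nat.Properties
open import Data.Fin using (Fin)
open import Data.Fin.Properties using (any?; all?)
open import Data.Fin.Subset
open import Data.Fin.Subset.Properties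
open import Data.Fin.Subset.Induction using (⊃-wellFounded)
open import Data.Vec.Base using ([]; _∷_; here; there)
open import Data.Product using (Σ; ∃; _×_; _,_; proj₁; proj₂)
open import Data.Sum as Sum using (_⊎_; inj₁; inj₂; [_,_])
open import Function using (_∘_)
open import Data.Empty using (⊥-elim)
open import Induction.WellFounded using (Acc; acc)
open import Relation.Nullary using (¬_; Dec; yes; no; ¬?)
open import Relation.Nullary.Decidable using (decidable-stable; _×-dec_; _→-dec_; _⊎-dec_; from-yes; from-no)
open import Relation.Unary using (Decidable)
open import Relation.Binary.PropositionalEquality using (_≡_; refl; sym; trans; cong; subst; subst₂; module ≡-Reasoning)
open import Function.Bundles using (_⇔_; mk⇔)

private variable
  n : ℕ
  p q r : Subset n
  x : Fin n
  E : Subset n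
  H : Family n

-- Finite sets

x∈p─q⇒x∉q : ∀ (p q : Subset n) → x ∈ p ─ q → x ∉ q
x∈p─q⇒x∉q (inside ∷ p) (outside ∷ q) here ()
x∈p─q⇒x∉q (_ ∷ p) (_ ∷ q) (there x∈p─q) (there x∈q) = x∈p─q⇒x∉q p q x∈p─q x∈q

x∈p─q⁻ : ∀ (p q : Subset n) → x ∈ p ─ q → x ∈ p × x ∉ q
x∈p─q⁻ p q x∈p─q = p─q⊆p p q x∈p─q , x∈p─q⇒x∉q p q x∈p─q

∪-lub : p ⊆ r → q ⊆ r → p ∪ q ⊆ r
∪-lub {p = p} {q = q} p⊆r q⊆r x∈p∪q with x∈p∪q⁻ p q x∈p∪q
... | inj₁ x∈p = p⊆r x∈p
... | inj₂ x∈q = q⊆r x∈q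

x∈p⇒⁅x⁆⊆p : x ∈ p → ⁅ x ⁆ ⊆ p
x∈p⇒⁅x⁆⊆p {x = x} {p = p} x∈p y∈⁅x⁆ = subst (_∈ p) (sym (x∈⁅y⁆⇒x≡y x y∈⁅x⁆)) x∈p

x∉p∧x∉q⇒x∉p∪q : x ∉ p → x ∉ q → x ∉ p ∪ q
x∉p∧x∉q⇒x∉p∪q x∉p x∉q = [ x∉p , x∉q ] ∘ x∈p∪q⁻ _ _

Disjoint : Subset n → Subset n → Set
Disjoint p q = ∀ {x} → x ∈ p → x ∉ q

∣p∪q∣+∣p∩q∣≡∣p∣+∣q∣ : ∀ (p q : Subset n) → ∣ p ∪ q ∣ + ∣ p ∩ q ∣ ≡ ∣ p ∣ + ∣ q ∣
∣p∪q∣+∣p∩q∣≡∣p∣+∣q∣ [] [] = refl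
∣p∪q∣+∣p∩q∣≡∣p∣+∣q∣ (inside ∷ p) (inside ∷ q) =
  cong suc (trans (+-suc _ _) (trans (cong suc (∣p∪q∣+∣p∩q∣≡∣p∣+∣q∣ p q)) (sym (+-suc _ _))))
∣p∪q∣+∣p∩q∣≡∣p∣+∣q∣ (inside ∷ p) (outside ∷ q) = cong suc (∣p∪q∣+∣p∩q∣≡∣p∣+∣q∣ p q)
∣p∪q∣+∣p∩q∣≡∣p∣+∣q∣ (outside ∷ p) (inside ∷ q) = trans (cong suc (∣p∪q∣+∣p∩q∣≡∣p∣+∣q∣ p q)) (sym (+-suc _ _))
∣p∪q∣+∣p∩q∣≡∣p∣+∣q∣ (outside ∷ p) (outside ∷ q) = ∣p∪q∣+∣p∩q∣≡∣p∣+∣q∣ p q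

∣p∣≡∣p∩q∣+∣p─q∣ : ∀ (p q : Subset n) → ∣ p ∣ ≡ ∣ p ∩ q ∣ + ∣ p ─ q ∣
∣p∣≡∣p∩q∣+∣p─q∣ [] [] = refl
∣p∣≡∣p∩q∣+∣p─q∣ (inside ∷ p) (inside ∷ q) = cong suc (∣p∣≡∣p∩q∣+∣p─q∣ p q)
∣p∣≡∣p∩q∣+∣p─q∣ (inside ∷ p) (outside ∷ q) = trans (cong suc (∣p∣≡∣p∩q∣+∣p─q∣ p q)) (sym (+-suc _ _))
∣p∣≡∣p∩q∣+∣p─q∣ (outside ∷ p) (inside ∷ q) = ∣p∣≡∣p∩q∣+∣p─q∣ p q
∣p∣≡∣p∩q∣+∣p─q∣ (outside ∷ p) (outside ∷ q) = ∣p∣≡∣p∩q∣+∣p─q∣ p q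

∣p∪q∣≤∣p∣+∣q∣ : ∀ (p q : Subset n) → ∣ p ∪ q ∣ ≤ ∣ p ∣ + ∣ q ∣
∣p∪q∣≤∣p∣+∣q∣ p q = subst (∣ p ∪ q ∣ ≤_) (∣p∪q∣+∣p∩q∣≡∣p∣+∣q∣ p q) (m≤m+n _ _)

Disjoint⇒∣p∪q∣≡∣p∣+∣q∣ : ∀ (p q : Subset n) → Disjoint p q → ∣ p ∪ q ∣ ≡ ∣ p ∣ + ∣ q ∣
Disjoint⇒∣p∪q∣≡∣p∣+∣q∣ {n} p q p#q = begin
  ∣ p ∪ q ∣                ≡⟨ +-identityʳ _ ⟨
  ∣ p ∪ q ∣ + 0            ≡⟨ cong (∣ p ∪ q ∣ +_) (trans (cong ∣_∣ p∩q≡⊥) (∣⊥∣≡0 n)) ⟨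
  ∣ p ∪ q ∣ + ∣ p ∩ q ∣    ≡⟨ ∣p∪q∣+∣p∩q∣≡∣p∣+∣q∣ p q ⟩
  ∣ p ∣ + ∣ q ∣            ∎
  where
  open ≡-Reasoning
  p∩q≡⊥ : p ∩ q ≡ ⊥
  p∩q≡⊥ = Empty-unique λ (_ , x∈p∩q) → let (x∈p , x∈q) = x∈p∩q⁻ p q x∈p∩q in p#q x∈p x∈q

x∉p⇒∣p∪⁅x⁆∣≡1+∣p∣ : ∀ (p : Subset n) → x ∉ p → ∣ p ∪ ⁅ x ⁆ ∣ ≡ suc ∣ p ∣
x∉p⇒∣p∪⁅x⁆∣≡1+∣p∣ {x = x} p x∉p = begin
  ∣ p ∪ ⁅ x ⁆ ∣       ≡⟨ Disjoint⇒∣p∪q∣≡∣p∣+∣q∣ p ⁅ x ⁆ (λ y∈p y∈⁅x⁆ → x∉p (subst (_∈ p) (x∈⁅y⁆⇒x≡y x y∈⁅x⁆) y∈p)) ⟩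
  ∣ p ∣ + ∣ ⁅ x ⁆ ∣   ≡⟨ cong (∣ p ∣ +_) (∣⁅x⁆∣≡1 x) ⟩
  ∣ p ∣ + 1           ≡⟨ +-comm ∣ p ∣ 1 ⟩
  suc ∣ p ∣           ∎
  where open ≡-Reasoning

⊆─⇒Disjoint : ∀ {s t : Subset n} → p ⊆ s ─ t → q ⊆ t → Disjoint p q
⊆─⇒Disjoint {s = s} {t} p⊆s─t q⊆t x∈p x∈q = x∈p─q⇒x∉q s t (p⊆s─t x∈p) (q⊆t x∈q)

q⊆r─p⇒p⊆r─q : p ⊆ r → q ⊆ r ─ p → p ⊆ r ─ q
q⊆r─p⇒p⊆r─q p⊆r q⊆r─p x∈p = x∈p∧x∉q⇒x∈p─q (p⊆r x∈p) λ x∈q → ⊆─⇒Disjoint q⊆r─p ⊆-refl x∈q x∈p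

p─r∪q⊆p∪q─r : Disjoint q r → (p ─ r) ∪ q ⊆ (p ∪ q) ─ r
p─r∪q⊆p∪q─r {q = q} {r = r} {p = p} q#r = ∪-lub
  (λ x∈p─r → let (x∈p , x∉r) = x∈p─q⁻ p r x∈p─r in x∈p∧x∉q⇒x∈p─q (p⊆p∪q q x∈p) x∉r)
  (λ x∈q → x∈p∧x∉q⇒x∈p─q (q⊆p∪q p q x∈q) (q#r x∈q))

─-antimonoʳ : ∀ {p q r : Subset n} → q ⊆ r → p ─ r ⊆ p ─ q
─-antimonoʳ {p = p} {r = r} q⊆r x∈p─r = let (x∈p , x∉r) = x∈p─q⁻ p r x∈p─r in x∈p∧x∉q⇒x∈p─q x∈p (x∉r ∘ q⊆r)

p─q⊆p∪q─p∩q : ∀ (p q : Subset n) → p ─ q ⊆ (p ∪ q) ─ (p ∩ q)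
p─q⊆p∪q─p∩q p q x∈p─q = let (x∈p , x∉q) = x∈p─q⁻ p q x∈p─q in
  x∈p∧x∉q⇒x∈p─q (p⊆p∪q q x∈p) (x∉q ∘ p∩q⊆q p q)

q─p⊆p∪q─p∩q : ∀ (p q : Subset n) → q ─ p ⊆ (p ∪ q) ─ (p ∩ q)
q─p⊆p∪q─p∩q p q x∈q─p = let (x∈q , x∉p) = x∈p─q⁻ q p x∈q─p in
  x∈p∧x∉q⇒x∈p─q (q⊆p∪q p q x∈q) (x∉p ∘ p∩q⊆p p q)

p-x⊆[p─q]-x∪p∩q : ∀ (p q : Subset n) → p - x ⊆ ((p ─ q) - x) ∪ (p ∩ q)
p-x⊆[p─q]-x∪p∩q {x = x} p q {y} y∈p-x with x∈p─q⁻ p ⁅ x ⁆ y∈p-x | y ∈? q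
... | y∈p , _ | yes y∈q = q⊆p∪q _ (p ∩ q) (x∈p∩q⁺ (y∈p , y∈q))
... | y∈p , y∉⁅x⁆ | no y∉q = p⊆p∪q (p ∩ q) (x∈p∧x∉q⇒x∈p─q (x∈p∧x∉q⇒x∈p─q y∈p y∉q) y∉⁅x⁆)

∣p∣≤1+∣p-x∣ : ∀ (p : Subset n) x → ∣ p ∣ ≤ suc ∣ p - x ∣
∣p∣≤1+∣p-x∣ p x = begin
  ∣ p ∣                      ≡⟨ ∣p∣≡∣p∩q∣+∣p─q∣ p ⁅ x ⁆ ⟩
  ∣ p ∩ ⁅ x ⁆ ∣ + ∣ p - x ∣  ≤⟨ +-monoˡ-≤ ∣ p - x ∣ (∣p∩q∣≤∣q∣ p ⁅ x ⁆) ⟩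
  ∣ ⁅ x ⁆ ∣ + ∣ p - x ∣      ≡⟨ cong (_+ ∣ p - x ∣) (∣⁅x⁆∣≡1 x) ⟩
  suc ∣ p - x ∣              ∎
  where open ≤-Reasoning

∣p∣≤∣p-x∪⁅y⁆∣ : ∀ {y} (p : Subset n) → y ∉ p → ∣ p ∣ ≤ ∣ (p - x) ∪ ⁅ y ⁆ ∣
∣p∣≤∣p-x∪⁅y⁆∣ {x = x} p y∉p = begin
  ∣ p ∣                    ≤⟨ ∣p∣≤1+∣p-x∣ p x ⟩
  suc ∣ p - x ∣            ≡⟨ x∉p⇒∣p∪⁅x⁆∣≡1+∣p∣ (p - x) (y∉p ∘ p─q⊆p p ⁅ x ⁆) ⟨
  ∣ (p - x) ∪ ⁅ _ ⁆ ∣      ∎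
  where open ≤-Reasoning

∣q─[p-x∪⁅y⁆]∣<∣q─p∣ : ∀ {y} (p q : Subset n) → x ∉ q → y ∈ q ─ p → ∣ q ─ ((p - x) ∪ ⁅ y ⁆) ∣ < ∣ q ─ p ∣
∣q─[p-x∪⁅y⁆]∣<∣q─p∣ {x = x} {y} p q x∉q y∈q─p =
  ≤-<-trans (p⊆q⇒∣p∣≤∣q∣ q─[p-x∪⁅y⁆]⊆[q─p]-y) (x∈p⇒∣p-x∣<∣p∣ y∈q─p)
  where
  q─[p-x∪⁅y⁆]⊆[q─p]-y : q ─ ((p - x) ∪ ⁅ y ⁆) ⊆ (q ─ p) - y
  q─[p-x∪⁅y⁆]⊆[q─p]-y z∈ = let (z∈q , z∉) = x∈p─q⁻ q _ z∈ in
    x∈p∧x∉q⇒x∈p─q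
      (x∈p∧x∉q⇒x∈p─q z∈q λ z∈p → z∉ (p⊆p∪q ⁅ y ⁆ (x∈p∧x∉q⇒x∈p─q z∈p λ z∈⁅x⁆ →
        x∉q (subst (_∈ q) (x∈⁅y⁆⇒x≡y x z∈⁅x⁆) z∈q))))
      (z∉ ∘ q⊆p∪q (p - x) ⁅ y ⁆)

∣p∣<∣q∣⇒∣p─q∣<∣q─p∣ : ∀ (p q : Subset n) → ∣ p ∣ < ∣ q ∣ → ∣ p ─ q ∣ < ∣ q ─ p ∣
∣p∣<∣q∣⇒∣p─q∣<∣q─p∣ p q ∣p∣<∣q∣ = +-cancelˡ-< ∣ p ∩ q ∣ _ _ (subst₂ _<_ ∣p∣≡ ∣q∣≡ ∣p∣<∣q∣)
  where
  ∣p∣≡ : ∣ p ∣ ≡ ∣ p ∩ q ∣ + ∣ p ─ q ∣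
  ∣p∣≡ = ∣p∣≡∣p∩q∣+∣p─q∣ p q
  ∣q∣≡ : ∣ q ∣ ≡ ∣ p ∩ q ∣ + ∣ q ─ p ∣
  ∣q∣≡ = trans (∣p∣≡∣p∩q∣+∣p─q∣ q p) (cong (λ s → ∣ s ∣ + ∣ q ─ p ∣) (∩-comm q p))

p⊆q∧∣q∣≤∣p∣⇒q⊆p : p ⊆ q → ∣ q ∣ ≤ ∣ p ∣ → q ⊆ p
p⊆q∧∣q∣≤∣p∣⇒q⊆p {p = p} p⊆q ∣q∣≤∣p∣ {x} x∈q = decidable-stable (x ∈? p) λ x∉p →
  <⇒≱ (p⊂q⇒∣p∣<∣q∣ (p⊆q , x , x∈q , x∉p)) ∣q∣≤∣p∣

∃⊆-of-size : ∀ (p : Subset n) k → k ≤ ∣ p ∣ → ∃ λ q → q ⊆ p × ∣ q ∣ ≡ k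
∃⊆-of-size {n} p zero _ = ⊥ , ⊥⊆ , ∣⊥∣≡0 n
∃⊆-of-size (inside ∷ p) (suc k) (s≤s k≤∣p∣) =
  let (q , q⊆p , ∣q∣≡k) = ∃⊆-of-size p k k≤∣p∣ in inside ∷ q , in⊆in q⊆p , cong suc ∣q∣≡k
∃⊆-of-size (outside ∷ p) (suc k) k<∣p∣ =
  let (q , q⊆p , ∣q∣≡k) = ∃⊆-of-size p (suc k) k<∣p∣ in outside ∷ q , out⊆ q⊆p , ∣q∣≡k

∃∈∉⊎⊆ : ∀ (p q : Subset n) → (∃ λ x → x ∈ p × x ∉ q) ⊎ p ⊆ q
∃∈∉⊎⊆ p q with any? (λ x → (x ∈? p) ×-dec ¬? (x ∈? q))
... | yes (x , x∈p , x∉q) = inj₁ (x , x∈p , x∉q)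
... | no ∄x = inj₂ λ {x} x∈p → decidable-stable (x ∈? q) λ x∉q → ∄x (x , x∈p , x∉q)

allSubset? : ∀ {P : Subset n → Set} → Decidable P → Dec (∀ s → P s)
allSubset? P? with anySubset? (¬? ∘ P?)
... | yes (s , ¬Ps) = no λ ∀P → ¬Ps (∀P s)
... | no ∄s = yes λ s → decidable-stable (P? s) λ ¬Ps → ∄s (s , ¬Ps)

-- Families of sets

StrongAugmentation : Family n → Set
StrongAugmentation H = ∀ I J → H I → H J → ∣ J ∣ < ∣ I ∣ → ∃ λ i → i ∈ I × i ∉ J × H (J ∪ ⁅ i ⁆)

maxIn-absorbs : ∀ {H : Family n} {X M} → IsMaxIn H X M → x ∈ X → H (M ∪ ⁅ x ⁆) → x ∈ M
maxIn-absorbs {x = x} {M = M} (M⊆X , _ , maximal) x∈X H[M+x] =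
  maximal (M ∪ ⁅ x ⁆) (∪-lub M⊆X (x∈p⇒⁅x⁆⊆p x∈X)) H[M+x] (p⊆p∪q ⁅ x ⁆) (q⊆p∪q M ⁅ x ⁆ (x∈⁅x⁆ x))

basis⇒maxIn : ∀ {H : Family n} {X B} → IsBasis H B → B ⊆ X → IsMaxIn H X B
basis⇒maxIn (HB , maximal) B⊆X = B⊆X , HB , λ C _ HC → maximal C HC

isMaxIn? : ∀ {H : Family n} → Decidable H → ∀ X → Decidable (IsMaxIn H X)
isMaxIn? H? X B = (B ⊆? X) ×-dec H? B ×-dec
  allSubset? λ C → (C ⊆? X) →-dec H? C →-dec (B ⊆? C) →-dec (C ⊆? B)

isBasis? : ∀ {H : Family n} → Decidable H → Decidable (IsBasis H)
isBasis? H? B = H? B ×-dec allSubset? λ C → H? C →-dec (B ⊆? C) →-dec (C ⊆? B)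

pointReplacement? : ∀ (E : Subset n) {H : Family n} → Decidable H → Dec (PointReplacement E H)
pointReplacement? E H? = all? λ p → (p ∈? E) →-dec H? ⁅ p ⁆ →-dec allSubset? λ J → H? J →-dec nonempty? J →-dec
  any? λ x → (x ∈? J) ×-dec H? ((J - x) ∪ ⁅ p ⁆)

module HereditaryCollection {E : Subset n} {H : Family n} (hc : IsHC E H) where
  open IsHC hc

  H⊥ : H ⊥
  H⊥ = hereditary _ ⊥ ⊥⊆ (proj₂ nonempty)

  extend-to-maxIn : ∀ {X A} → A ⊆ X → H A → ∃ λ B → A ⊆ B × IsMaxIn H X B
  extend-to-maxIn = go (⊃-wellFounded _)
    where
    go : ∀ {X A} → Acc _⊃_ A → A ⊆ X → H A → ∃ λ B → A ⊆ B × IsMaxIn H X B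
    go {X} {A} (acc larger) A⊆X HA with anySubset? (λ C → (C ⊆? X) ×-dec decidable C ×-dec (A ⊂? C))
    ... | yes (C , C⊆X , HC , A⊂C) =
      let (B , C⊆B , B-max) = go (larger A⊂C) C⊆X HC in B , ⊆-trans (proj₁ A⊂C) C⊆B , B-max
    ... | no ∄C = A , ⊆-refl , A⊆X , HA , λ C C⊆X HC A⊆C {x} x∈C →
      decidable-stable (x ∈? A) λ x∉A → ∄C (C , C⊆X , HC , A⊆C , x , x∈C , x∉A)

  ∃-basis : ∃ (IsBasis H)
  ∃-basis = let (B , _ , _ , HB , maximal) = extend-to-maxIn {X = E} ⊥⊆ H⊥ in
    B , HB , λ C HC → maximal C (ground C HC) HC

  isHC-Del : ∀ X → IsHC (E ─ X) (Del E H X)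
  isHC-Del X = record
    { ground     = λ _ → proj₂
    ; nonempty   = ⊥ , H⊥ , ⊥⊆
    ; hereditary = λ Y Z Z⊆Y (HY , Y⊆E─X) → hereditary Y Z Z⊆Y HY , ⊆-trans Z⊆Y Y⊆E─X
    ; decidable  = λ Y → decidable Y ×-dec (Y ⊆? E ─ X)
    }

  isHC-Contr : ∀ X → IsHC (E ─ X) (Contr E H X)
  isHC-Contr X = record
    { ground     = λ _ → proj₁
    ; nonempty   = let (B , _ , B-max@(_ , HB , _)) = extend-to-maxIn ⊥⊆ H⊥ in
                   ⊥ , ⊥⊆ , B , B-max , hereditary B (⊥ ∪ B) (∪-lub ⊥⊆ ⊆-refl) HB
    ; hereditary = λ Y Z Z⊆Y (Y⊆E─X , B , B-max , H[Y∪B]) →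
                   ⊆-trans Z⊆Y Y⊆E─X , B , B-max ,
                   hereditary (Y ∪ B) (Z ∪ B) (∪-lub (⊆-trans Z⊆Y (p⊆p∪q B)) (q⊆p∪q Y B)) H[Y∪B]
    ; decidable  = λ Y → (Y ⊆? E ─ X) ×-dec anySubset? λ B → isMaxIn? decidable X B ×-dec decidable (Y ∪ B)
    }

  isHC-Dual : IsHC E (Dual E H)
  isHC-Dual = record
    { ground     = λ Y (B , _ , Y⊆E─B) → ⊆-trans Y⊆E─B (p─q⊆p E B)
    ; nonempty   = let (B , B-basis) = ∃-basis in ⊥ , B , B-basis , ⊥⊆
    ; hereditary = λ _ _ Z⊆Y (B , B-basis , Y⊆E─B) → B , B-basis , ⊆-trans Z⊆Y Y⊆E─B
    ; decidable  = λ Y → anySubset? λ B → isBasis? decidable B ×-dec (Y ⊆? E ─ B)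
    }

  module Matroid (augment : StrongAugmentation H) where

    ∣indep∣≤∣maxIn∣ : ∀ {X M J} → IsMaxIn H X M → J ⊆ X → H J → ∣ J ∣ ≤ ∣ M ∣
    ∣indep∣≤∣maxIn∣ M-max@(_ , HM , _) J⊆X HJ = ≮⇒≥ λ ∣M∣<∣J∣ →
      let (e , e∈J , e∉M , H[M+e]) = augment _ _ HJ HM ∣M∣<∣J∣
      in e∉M (maxIn-absorbs M-max (J⊆X e∈J) H[M+e])

    maxIn⇒basis : ∀ {X B B′} → IsMaxIn H X B → IsBasis H B′ → B′ ⊆ X → IsBasis H B
    maxIn⇒basis {B = B} {B′} B-max@(_ , HB , _) B′-basis@(HB′ , _) B′⊆X = HB , λ C HC B⊆C {x} x∈C →
      decidable-stable (x ∈? B) λ x∉B → n≮n ∣ B ∣ (begin-strict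
        ∣ B ∣             <⟨ n<1+n ∣ B ∣ ⟩
        suc ∣ B ∣         ≡⟨ x∉p⇒∣p∪⁅x⁆∣≡1+∣p∣ B x∉B ⟨
        ∣ B ∪ ⁅ x ⁆ ∣     ≤⟨ ∣indep∣≤∣maxIn∣ (basis⇒maxIn B′-basis ⊆⊤) ⊆⊤
                               (hereditary C _ (∪-lub B⊆C (x∈p⇒⁅x⁆⊆p x∈C)) HC) ⟩
        ∣ B′ ∣            ≤⟨ ∣indep∣≤∣maxIn∣ B-max B′⊆X HB′ ⟩
        ∣ B ∣             ∎)
      where open ≤-Reasoning

    maxIn-omits-at-most-one : ∀ {J M p} → H J → Nonempty J → p ∉ J → p ∈ M →
                              IsMaxIn H (J ∪ ⁅ p ⁆) M → ∃ λ x → x ∈ J × (J ∪ ⁅ p ⁆) - x ⊆ M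
    maxIn-omits-at-most-one {J} {M} {p} HJ (x₀ , x₀∈J) p∉J p∈M M-max@(M⊆J+p , _ , _)
      with ∃∈∉⊎⊆ (J ∪ ⁅ p ⁆) M
    ... | inj₂ J+p⊆M = x₀ , x₀∈J , ⊆-trans (p─q⊆p (J ∪ ⁅ p ⁆) ⁅ x₀ ⁆) J+p⊆M
    ... | inj₁ (x , x∈J+p , x∉M) = x , x∈J , p⊆q∧∣q∣≤∣p∣⇒q⊆p M⊆J+p-x ∣J+p-x∣≤∣M∣
      where
      x∈J : x ∈ J
      x∈J with x∈p∪q⁻ J ⁅ p ⁆ x∈J+p
      ... | inj₁ x∈J = x∈J
      ... | inj₂ x∈⁅p⁆ = ⊥-elim (x∉M (subst (_∈ M) (sym (x∈⁅y⁆⇒x≡y p x∈⁅p⁆)) p∈M))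
      M⊆J+p-x : M ⊆ (J ∪ ⁅ p ⁆) - x
      M⊆J+p-x y∈M = x∈p∧x∉q⇒x∈p─q (M⊆J+p y∈M) λ y∈⁅x⁆ → x∉M (subst (_∈ M) (x∈⁅y⁆⇒x≡y x y∈⁅x⁆) y∈M)
      ∣J+p-x∣≤∣M∣ : ∣ (J ∪ ⁅ p ⁆) - x ∣ ≤ ∣ M ∣
      ∣J+p-x∣≤∣M∣ = begin
        ∣ (J ∪ ⁅ p ⁆) - x ∣  ≤⟨ ≤-pred (subst (suc ∣ (J ∪ ⁅ p ⁆) - x ∣ ≤_) (x∉p⇒∣p∪⁅x⁆∣≡1+∣p∣ J p∉J) (x∈p⇒∣p-x∣<∣p∣ x∈J+p)) ⟩
        ∣ J ∣                ≤⟨ ∣indep∣≤∣maxIn∣ M-max (p⊆p∪q ⁅ p ⁆) HJ ⟩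
        ∣ M ∣                ∎
        where open ≤-Reasoning

    pointReplacement : PointReplacement E H
    pointReplacement p _ H⁅p⁆ J HJ J≢∅ with p ∈? J
    ... | yes p∈J = p , p∈J , hereditary J _ (∪-lub (p─q⊆p J ⁅ p ⁆) (x∈p⇒⁅x⁆⊆p p∈J)) HJ
    ... | no p∉J with extend-to-maxIn {X = J ∪ ⁅ p ⁆} (q⊆p∪q J ⁅ p ⁆) H⁅p⁆
    ... | M , ⁅p⁆⊆M , M-max@(_ , HM , _) with maxIn-omits-at-most-one HJ J≢∅ p∉J (⁅p⁆⊆M (x∈⁅x⁆ p)) M-max
    ... | x , x∈J , J+p-x⊆M = x , x∈J , hereditary M _ (⊆-trans J-x+p⊆J+p-x J+p-x⊆M) HM
      where
      J-x+p⊆J+p-x : (J - x) ∪ ⁅ p ⁆ ⊆ (J ∪ ⁅ p ⁆) - x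
      J-x+p⊆J+p-x = p─r∪q⊆p∪q─r λ y∈⁅p⁆ y∈⁅x⁆ →
        p∉J (subst (_∈ J) (trans (sym (x∈⁅y⁆⇒x≡y x y∈⁅x⁆)) (x∈⁅y⁆⇒x≡y p y∈⁅p⁆)) x∈J)

    Contr-base-irrelevant : ∀ {X J B₁ B₂} → J ⊆ E ─ X → IsMaxIn H X B₁ → IsMaxIn H X B₂ →
                            H (J ∪ B₂) → H (J ∪ B₁)
    Contr-base-irrelevant {X} {J} {B₁} {B₂} J⊆E─X B₁-max@(B₁⊆X , HB₁ , _) B₂-max@(B₂⊆X , _ , _) H[J∪B₂]
      with extend-to-maxIn {X = J ∪ X} (⊆-trans B₁⊆X (q⊆p∪q J X)) HB₁
    ... | M , B₁⊆M , M-max@(M⊆J∪X , HM , _) =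
      hereditary M (J ∪ B₁) (p⊆q∧∣q∣≤∣p∣⇒q⊆p M⊆J∪B₁ ∣J∪B₁∣≤∣M∣) HM
      where
      M⊆J∪B₁ : M ⊆ J ∪ B₁
      M⊆J∪B₁ {y} y∈M with x∈p∪q⁻ J X (M⊆J∪X y∈M)
      ... | inj₁ y∈J = p⊆p∪q B₁ y∈J
      ... | inj₂ y∈X = q⊆p∪q J B₁
        (maxIn-absorbs B₁-max y∈X (hereditary M _ (∪-lub B₁⊆M (x∈p⇒⁅x⁆⊆p y∈M)) HM))
      ∣J∪B₁∣≤∣M∣ : ∣ J ∪ B₁ ∣ ≤ ∣ M ∣
      ∣J∪B₁∣≤∣M∣ = begin
        ∣ J ∪ B₁ ∣       ≤⟨ ∣p∪q∣≤∣p∣+∣q∣ J B₁ ⟩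
        ∣ J ∣ + ∣ B₁ ∣   ≤⟨ +-monoʳ-≤ ∣ J ∣ (∣indep∣≤∣maxIn∣ B₂-max B₁⊆X HB₁) ⟩
        ∣ J ∣ + ∣ B₂ ∣   ≡⟨ Disjoint⇒∣p∪q∣≡∣p∣+∣q∣ J B₂ (⊆─⇒Disjoint J⊆E─X B₂⊆X) ⟨
        ∣ J ∪ B₂ ∣       ≤⟨ ∣indep∣≤∣maxIn∣ M-max (∪-lub (p⊆p∪q X) (⊆-trans B₂⊆X (q⊆p∪q J X))) H[J∪B₂] ⟩
        ∣ M ∣            ∎
        where open ≤-Reasoning

    augmentation-Contr : ∀ X → Augmentation (Contr E H X)
    augmentation-Contr X I J (I⊆E─X , B₁ , B₁-max , H[I∪B₁]) (J⊆E─X , B₂ , B₂-max , H[J∪B₂]) ∣I∣≡1+∣J∣ =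
      lift (augment (I ∪ B₁) (J ∪ B₁) H[I∪B₁] (Contr-base-irrelevant J⊆E─X B₁-max B₂-max H[J∪B₂]) ∣J∪B₁∣<∣I∪B₁∣)
      where
      B₁⊆X : B₁ ⊆ X
      B₁⊆X = proj₁ B₁-max
      ∣J∪B₁∣<∣I∪B₁∣ : ∣ J ∪ B₁ ∣ < ∣ I ∪ B₁ ∣
      ∣J∪B₁∣<∣I∪B₁∣ = subst₂ _<_
        (sym (Disjoint⇒∣p∪q∣≡∣p∣+∣q∣ J B₁ (⊆─⇒Disjoint J⊆E─X B₁⊆X)))
        (sym (Disjoint⇒∣p∪q∣≡∣p∣+∣q∣ I B₁ (⊆─⇒Disjoint I⊆E─X B₁⊆X)))
        (+-monoˡ-< ∣ B₁ ∣ (≤-reflexive (sym ∣I∣≡1+∣J∣)))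
      lift : (∃ λ i → i ∈ I ∪ B₁ × i ∉ J ∪ B₁ × H ((J ∪ B₁) ∪ ⁅ i ⁆)) →
             ∃ λ i → i ∈ I × i ∉ J × Contr E H X (J ∪ ⁅ i ⁆)
      lift (i , i∈I∪B₁ , i∉J∪B₁ , H[J∪B₁+i]) =
        i , i∈I , i∉J∪B₁ ∘ p⊆p∪q B₁ , ∪-lub J⊆E─X (x∈p⇒⁅x⁆⊆p (I⊆E─X i∈I)) , B₁ , B₁-max ,
        hereditary _ _ (∪-lub (∪-lub (⊆-trans (p⊆p∪q B₁) (p⊆p∪q ⁅ i ⁆)) (q⊆p∪q (J ∪ B₁) ⁅ i ⁆))
                              (⊆-trans (q⊆p∪q J B₁) (p⊆p∪q ⁅ i ⁆))) H[J∪B₁+i]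
        where
        i∈I : i ∈ I
        i∈I with x∈p∪q⁻ I B₁ i∈I∪B₁
        ... | inj₁ i∈I = i∈I
        ... | inj₂ i∈B₁ = ⊥-elim (i∉J∪B₁ (q⊆p∪q J B₁ i∈B₁))

    basis⊇T∪[I─J]⇒∣I─J∣≤∣J─I∣ : ∀ {I J T B B′} → IsMaxIn H (E ─ (I ∪ J)) T →
                                 IsBasis H B → T ⊆ B → I ─ J ⊆ B →
                                 IsBasis H B′ → B′ ⊆ E ─ I → ∣ I ─ J ∣ ≤ ∣ J ─ I ∣
    basis⊇T∪[I─J]⇒∣I─J∣≤∣J─I∣ {I} {J} {T} {B} T-max@(T⊆E─I∪J , HT , _) (HB , _) T⊆B I─J⊆B B′-basis B′⊆E─I
      with extend-to-maxIn {X = E ─ I} (⊆-trans T⊆E─I∪J (─-antimonoʳ (p⊆p∪q J))) HT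
    ... | B″ , T⊆B″ , B″-max@(B″⊆E─I , HB″ , _) = +-cancelˡ-≤ ∣ T ∣ _ _ (begin
      ∣ T ∣ + ∣ I ─ J ∣   ≡⟨ Disjoint⇒∣p∪q∣≡∣p∣+∣q∣ T (I ─ J)
                               (⊆─⇒Disjoint T⊆E─I∪J (⊆-trans (p─q⊆p I J) (p⊆p∪q J))) ⟨
      ∣ T ∪ (I ─ J) ∣     ≤⟨ p⊆q⇒∣p∣≤∣q∣ (∪-lub T⊆B I─J⊆B) ⟩
      ∣ B ∣               ≤⟨ ∣indep∣≤∣maxIn∣ (basis⇒maxIn (maxIn⇒basis B″-max B′-basis B′⊆E─I) ⊆⊤) ⊆⊤ HB ⟩
      ∣ B″ ∣              ≤⟨ p⊆q⇒∣p∣≤∣q∣ B″⊆T∪[J─I] ⟩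
      ∣ T ∪ (J ─ I) ∣     ≤⟨ ∣p∪q∣≤∣p∣+∣q∣ T (J ─ I) ⟩
      ∣ T ∣ + ∣ J ─ I ∣   ∎)
      where
      open ≤-Reasoning
      B″⊆T∪[J─I] : B″ ⊆ T ∪ (J ─ I)
      B″⊆T∪[J─I] {y} y∈B″ with x∈p─q⁻ E I (B″⊆E─I y∈B″) | y ∈? J
      ... | _ , y∉I | yes y∈J = q⊆p∪q T (J ─ I) (x∈p∧x∉q⇒x∈p─q y∈J y∉I)
      ... | y∈E , y∉I | no y∉J = p⊆p∪q (J ─ I) (maxIn-absorbs T-max
        (x∈p∧x∉q⇒x∈p─q y∈E (x∉p∧x∉q⇒x∉p∪q y∉I y∉J)) (hereditary B″ _ (∪-lub T⊆B″ (x∈p⇒⁅x⁆⊆p y∈B″)) HB″))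

    augmentation-Dual : Augmentation (Dual E H)
    augmentation-Dual I J (B₁ , B₁-basis , I⊆E─B₁) (B₂ , B₂-basis , J⊆E─B₂) ∣I∣≡1+∣J∣
      with extend-to-maxIn {X = E ─ (I ∪ J)} ⊥⊆ H⊥
    ... | T , _ , T-max@(T⊆E─I∪J , HT , _)
      with extend-to-maxIn {X = E ─ J} (⊆-trans T⊆E─I∪J (─-antimonoʳ (q⊆p∪q I J))) HT
    ... | B , T⊆B , B-max@(B⊆E─J , _)
      with maxIn⇒basis B-max B₂-basis (q⊆r─p⇒p⊆r─q (ground B₂ (proj₁ B₂-basis)) J⊆E─B₂) | ∃∈∉⊎⊆ (I ─ J) B
    ... | B-basis | inj₂ I─J⊆B = ⊥-elim (<⇒≱ (∣p∣<∣q∣⇒∣p─q∣<∣q─p∣ J I (≤-reflexive (sym ∣I∣≡1+∣J∣)))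
          (basis⊇T∪[I─J]⇒∣I─J∣≤∣J─I∣ T-max B-basis T⊆B I─J⊆B B₁-basis
            (q⊆r─p⇒p⊆r─q (ground B₁ (proj₁ B₁-basis)) I⊆E─B₁)))
    ... | B-basis | inj₁ (i , i∈I─J , i∉B) = i , i∈I , i∉J , B , B-basis ,
          ∪-lub (q⊆r─p⇒p⊆r─q (⊆-trans J⊆E─B₂ (p─q⊆p E B₂)) B⊆E─J)
                (x∈p⇒⁅x⁆⊆p (x∈p∧x∉q⇒x∈p─q (p─q⊆p E B₁ (I⊆E─B₁ i∈I)) i∉B))
      where
      i∈I : i ∈ I
      i∈I = proj₁ (x∈p─q⁻ I J i∈I─J)
      i∉J : i ∉ J
      i∉J = proj₂ (x∈p─q⁻ I J i∈I─J)

augmentation⇒strong : IsHC E H → Augmentation H → StrongAugmentation H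
augmentation⇒strong hc augment I J HI HJ ∣J∣<∣I∣ =
  let (I′ , I′⊆I , ∣I′∣≡1+∣J∣) = ∃⊆-of-size I (suc ∣ J ∣) ∣J∣<∣I∣
      (i , i∈I′ , i∉J , H[J+i]) = augment I′ J (IsHC.hereditary hc I I′ I′⊆I HI) HJ ∣I′∣≡1+∣J∣
  in i , I′⊆I i∈I′ , i∉J , H[J+i]

open HereditaryCollection

matroid-Del : ∀ X → IsMatroid E H → IsMatroid (E ─ X) (Del E H X)
matroid-Del X (hc , augment) = isHC-Del hc X , λ I J (HI , I⊆E─X) (HJ , J⊆E─X) ∣I∣≡1+∣J∣ →
  let (i , i∈I , i∉J , H[J+i]) = augment I J HI HJ ∣I∣≡1+∣J∣
  in i , i∈I , i∉J , H[J+i] , ∪-lub J⊆E─X (x∈p⇒⁅x⁆⊆p (I⊆E─X i∈I))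

matroid-Contr : ∀ X → IsMatroid E H → IsMatroid (E ─ X) (Contr E H X)
matroid-Contr X (hc , augment) =
  isHC-Contr hc X , Matroid.augmentation-Contr hc (augmentation⇒strong hc augment) X

matroid-Dual : IsMatroid E H → IsMatroid E (Dual E H)
matroid-Dual (hc , augment) = isHC-Dual hc , Matroid.augmentation-Dual hc (augmentation⇒strong hc augment)

matroid-Minor : ∀ X Y → IsMatroid E H → IsMatroid (MinorGround E X Y) (Minor E H X Y)
matroid-Minor X Y = matroid-Del Y ∘ matroid-Contr X

matroid⇒pointReplacement : IsMatroid E H → PointReplacement E H
matroid⇒pointReplacement (hc , augment) = Matroid.pointReplacement hc (augmentation⇒strong hc augment)

pointReplacement-Del : ∀ X → PointReplacement E H → PointReplacement (E ─ X) (Del E H X)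
pointReplacement-Del {E = E} X replace p p∈E─X (H⁅p⁆ , _) J (HJ , J⊆E─X) J≢∅ =
  let (x , x∈J , H[J-x+p]) = replace p (p─q⊆p E X p∈E─X) H⁅p⁆ J HJ J≢∅
  in x , x∈J , H[J-x+p] , ∪-lub (⊆-trans (p─q⊆p J ⁅ x ⁆) J⊆E─X) (x∈p⇒⁅x⁆⊆p p∈E─X)

module MinorPointReplacement {n} {E : Subset n} {H : Family n} (hc : IsHC E H)
  (replace : ∀ X Y → X ⊆ E → Y ⊆ E ─ X → PointReplacement (MinorGround E X Y) (Minor E H X Y)) where
  open IsHC hc

  module _ {I J : Subset n} (HI : H I) (HJ : H J) where

    outside-I∪J : Subset n
    outside-I∪J = E ─ (I ∩ J) ─ (I ∪ J)

    I∪J─I∩J⊆ground : (I ∪ J) ─ (I ∩ J) ⊆ MinorGround E (I ∩ J) outside-I∪J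
    I∪J─I∩J⊆ground y∈ = let (y∈I∪J , y∉I∩J) = x∈p─q⁻ (I ∪ J) (I ∩ J) y∈ in
      x∈p∧x∉q⇒x∈p─q (x∈p∧x∉q⇒x∈p─q (∪-lub (ground I HI) (ground J HJ) y∈I∪J) y∉I∩J)
                     (λ y∈outside → x∈p─q⇒x∉q (E ─ (I ∩ J)) (I ∪ J) y∈outside y∈I∪J)

    minor-member : ∀ {Z} → Z ⊆ (I ∪ J) ─ (I ∩ J) → H (Z ∪ (I ∩ J)) → Minor E H (I ∩ J) outside-I∪J Z
    minor-member Z⊆ H[Z∪I∩J] =
      (⊆-trans Z⊆ (⊆-trans I∪J─I∩J⊆ground (p─q⊆p _ outside-I∪J)) , I ∩ J , I∩J-maxIn , H[Z∪I∩J]) ,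
      ⊆-trans Z⊆ I∪J─I∩J⊆ground
      where
      I∩J-maxIn : IsMaxIn H (I ∩ J) (I ∩ J)
      I∩J-maxIn = ⊆-refl , hereditary I _ (p∩q⊆p I J) HI , λ _ C⊆I∩J _ _ → C⊆I∩J

    replace-in-I∪J/I∩J : ∀ {p x₀} → p ∈ J ─ I → x₀ ∈ I ─ J → ∃ λ x → x ∈ I ─ J × H ((I - x) ∪ ⁅ p ⁆)
    replace-in-I∪J/I∩J {p} {x₀} p∈J─I x₀∈I─J
      with replace (I ∩ J) outside-I∪J (⊆-trans (p∩q⊆p I J) (ground I HI)) (p─q⊆p _ (I ∪ J))
             p (I∪J─I∩J⊆ground (q─p⊆p∪q─p∩q I J p∈J─I))
             (minor-member (x∈p⇒⁅x⁆⊆p (q─p⊆p∪q─p∩q I J p∈J─I))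
                           (hereditary J _ (∪-lub (x∈p⇒⁅x⁆⊆p (p─q⊆p J I p∈J─I)) (p∩q⊆q I J)) HJ))
             (I ─ J) (minor-member (p─q⊆p∪q─p∩q I J) (hereditary I _ (∪-lub (p─q⊆p I J) (p∩q⊆p I J)) HI))
             (x₀ , x₀∈I─J)
    ... | x , x∈I─J , (_ , B , (B⊆I∩J , _ , B-max) , H[Z∪B]) , _ =
      x , x∈I─J , hereditary _ _ (⊆-trans I-x+p⊆Z∪I∩J Z∪I∩J⊆Z∪B) H[Z∪B]
      where
      Z : Subset n
      Z = ((I ─ J) - x) ∪ ⁅ p ⁆
      I-x+p⊆Z∪I∩J : (I - x) ∪ ⁅ p ⁆ ⊆ Z ∪ (I ∩ J)
      I-x+p⊆Z∪I∩J = ∪-lub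
        (⊆-trans (p-x⊆[p─q]-x∪p∩q I J) (∪-lub (⊆-trans (p⊆p∪q ⁅ p ⁆) (p⊆p∪q (I ∩ J))) (q⊆p∪q Z (I ∩ J))))
        (⊆-trans (q⊆p∪q ((I ─ J) - x) ⁅ p ⁆) (p⊆p∪q (I ∩ J)))
      Z∪I∩J⊆Z∪B : Z ∪ (I ∩ J) ⊆ Z ∪ B
      Z∪I∩J⊆Z∪B = ∪-lub (p⊆p∪q B)
        (⊆-trans (B-max (I ∩ J) ⊆-refl (hereditary I _ (p∩q⊆p I J) HI) B⊆I∩J) (q⊆p∪q Z B))

  augment-below : ∀ k I J → H I → H J → ∣ J ∣ < ∣ I ∣ → ∣ J ─ I ∣ < k →
                  ∃ λ i → i ∈ I × i ∉ J × H (J ∪ ⁅ i ⁆)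
  augment-below k I J HI HJ ∣J∣<∣I∣ _ with ∃∈∉⊎⊆ I J
  ... | inj₂ I⊆J = ⊥-elim (<⇒≱ ∣J∣<∣I∣ (p⊆q⇒∣p∣≤∣q∣ I⊆J))
  ... | inj₁ (x₀ , x₀∈I , x₀∉J) with ∃∈∉⊎⊆ J I
  ... | inj₂ J⊆I = x₀ , x₀∈I , x₀∉J , hereditary I _ (∪-lub J⊆I (x∈p⇒⁅x⁆⊆p x₀∈I)) HI
  augment-below zero I J HI HJ ∣J∣<∣I∣ () | inj₁ _ | inj₁ _
  augment-below (suc k) I J HI HJ ∣J∣<∣I∣ ∣J─I∣≤k | inj₁ (x₀ , x₀∈I , x₀∉J) | inj₁ (p , p∈J , p∉I)
    with replace-in-I∪J/I∩J HI HJ (x∈p∧x∉q⇒x∈p─q p∈J p∉I) (x∈p∧x∉q⇒x∈p─q x₀∈I x₀∉J)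
  ... | x , x∈I─J , H[I-x+p]
    with augment-below k ((I - x) ∪ ⁅ p ⁆) J H[I-x+p] HJ
           (<-≤-trans ∣J∣<∣I∣ (∣p∣≤∣p-x∪⁅y⁆∣ I p∉I))
           (<-≤-trans (∣q─[p-x∪⁅y⁆]∣<∣q─p∣ I J (x∈p─q⇒x∉q I J x∈I─J) (x∈p∧x∉q⇒x∈p─q p∈J p∉I)) (≤-pred ∣J─I∣≤k))
  ... | i , i∈I-x+p , i∉J , H[J+i] = i , i∈I , i∉J , H[J+i]
    where
    i∈I : i ∈ I
    i∈I with x∈p∪q⁻ (I - x) ⁅ p ⁆ i∈I-x+p
    ... | inj₁ i∈I-x = p─q⊆p I ⁅ x ⁆ i∈I-x
    ... | inj₂ i∈⁅p⁆ = ⊥-elim (i∉J (subst (_∈ J) (sym (x∈⁅y⁆⇒x≡y p i∈⁅p⁆)) p∈J))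

  augmentation : Augmentation H
  augmentation I J HI HJ ∣I∣≡1+∣J∣ = augment-below (suc ∣ J ─ I ∣) I J HI HJ (≤-reflexive (sym ∣I∣≡1+∣J∣)) ≤-refl

-- The hereditary closure of {0,1}, {0,2,3} and {1,2,3}. Contracting 0 leaves the maximal sets {1} and {2,3},
-- and 1 cannot replace a point of {2,3}; the dual, with bases {2,3}, {1} and {0}, fails in the same way.
threeFacets : Family 4
threeFacets Y = Y ⊆ (inside ∷ inside ∷ outside ∷ outside ∷ [])
              ⊎ Y ⊆ (inside ∷ outside ∷ inside ∷ inside ∷ [])
              ⊎ Y ⊆ (outside ∷ inside ∷ inside ∷ inside ∷ [])

threeFacets-isHC : IsHC ⊤ threeFacets
threeFacets-isHC = record
  { ground     = λ _ _ → ⊆⊤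
  ; nonempty   = ⊥ , inj₁ ⊥⊆
  ; hereditary = λ _ _ Z⊆Y → Sum.map (⊆-trans Z⊆Y) (Sum.map (⊆-trans Z⊆Y) (⊆-trans Z⊆Y))
  ; decidable  = λ Y → (Y ⊆? _) ⊎-dec (Y ⊆? _) ⊎-dec (Y ⊆? _)
  }

⁅0⁆ : Subset 4
⁅0⁆ = inside ∷ outside ∷ outside ∷ outside ∷ []

threeFacets-pointReplacement : PointReplacement ⊤ threeFacets
threeFacets-pointReplacement = from-yes (pointReplacement? ⊤ (IsHC.decidable threeFacets-isHC))

threeFacets/0-¬pointReplacement : ¬ PointReplacement (⊤ ─ ⁅0⁆) (Contr ⊤ threeFacets ⁅0⁆)
threeFacets/0-¬pointReplacement =
  from-no (pointReplacement? (⊤ ─ ⁅0⁆) (IsHC.decidable (isHC-Contr threeFacets-isHC ⁅0⁆)))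

threeFacets*-¬pointReplacement : ¬ PointReplacement ⊤ (Dual ⊤ threeFacets)
threeFacets*-¬pointReplacement = from-no (pointReplacement? ⊤ (IsHC.decidable (isHC-Dual threeFacets-isHC)))

threeFacets/0\∅-¬pointReplacement : ¬ PointReplacement (MinorGround ⊤ ⁅0⁆ ⊥) (Minor ⊤ threeFacets ⁅0⁆ ⊥)
threeFacets/0\∅-¬pointReplacement = from-no (pointReplacement? (MinorGround ⊤ ⁅0⁆ ⊥)
  (IsHC.decidable (isHC-Del (isHC-Contr threeFacets-isHC ⁅0⁆) ⊥)))

proposition2p26 :
    ((∀ {n} (E : Subset n) (H : Family n) → IsMatroid E H → IsMatroid E (Dual E H))
     × (∀ {n} (E : Subset n) (H : Family n) (X : Subset n) → X ⊆ E → IsMatroid E H → IsMatroid (E ─ X) (Del E H X))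
     × (∀ {n} (E : Subset n) (H : Family n) (X : Subset n) → X ⊆ E → IsMatroid E H → IsMatroid (E ─ X) (Contr E H X))
     × (∀ {n} (E : Subset n) (H : Family n) (X Y : Subset n) → X ⊆ E → Y ⊆ E ─ X → IsMatroid E H → IsMatroid (MinorGround E X Y) (Minor E H X Y)))
    × ((∀ {n} (E : Subset n) (H : Family n) (X : Subset n) → X ⊆ E → IsHC E H → PointReplacement E H → IsHC (E ─ X) (Del E H X) × PointReplacement (E ─ X) (Del E H X))
     × (∃ λ n → Σ (Subset n) λ E → Σ (Family n) λ H → Σ (Subset n) λ X → X ⊆ E × IsHC E H × PointReplacement E H × ¬ PointReplacement (E ─ X) (Contr E H X))
     × (∃ λ n → Σ (Subset n) λ E → Σ (Family n) λ H → IsHC E H × PointReplacement E H × ¬ PointReplacement E (Dual E H))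
     × (∃ λ n → Σ (Subset n) λ E → Σ (Family n) λ H → Σ (Subset n) λ X → Σ (Subset n) λ Y → X ⊆ E × Y ⊆ E ─ X × IsHC E H × PointReplacement E H × ¬ PointReplacement (MinorGround E X Y) (Minor E H X Y)))
    × (∀ {n} (E : Subset n) (H : Family n) → IsHC E H → (IsMatroid E H ⇔ (∀ (X Y : Subset n) → X ⊆ E → Y ⊆ E ─ X → PointReplacement (MinorGround E X Y) (Minor E H X Y))))
proposition2p26 =
  ( (λ _ _ → matroid-Dual)
  , (λ _ _ X _ → matroid-Del X)
  , (λ _ _ X _ → matroid-Contr X)
  , (λ _ _ X Y _ _ → matroid-Minor X Y) )
  , ( (λ _ _ X _ hc replace → isHC-Del hc X , pointReplacement-Del X replace)
    , (4 , ⊤ , threeFacets , ⁅0⁆ , ⊆⊤ , threeFacets-isHC , threeFacets-pointReplacement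
         , threeFacets/0-¬pointReplacement)
    , (4 , ⊤ , threeFacets , threeFacets-isHC , threeFacets-pointReplacement , threeFacets*-¬pointReplacement)
    , (4 , ⊤ , threeFacets , ⁅0⁆ , ⊥ , ⊆⊤ , ⊥⊆ , threeFacets-isHC , threeFacets-pointReplacement
         , threeFacets/0\∅-¬pointReplacement) )
  , λ _ _ hc → mk⇔
      (λ matroid X Y _ _ → matroid⇒pointReplacement (matroid-Minor X Y matroid))
      (λ replace → hc , MinorPointReplacement.augmentation hc replace)
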